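{- Let $R=(R[1],\dots,R[n])$ be a row with entries in $\{0,1,2\}$, and let $\rho$ be its number of markers. Then $R$ has a segmentation in which the number of segments with value $1$ is at most $\frac12\rho$ and the number of segments with value $2$ is at most $\frac14\rho+\frac12$.
   Context: A segment of a $1\times n$ row is a $1\times n$ row with non-negative integer entries whose non-zero entries all equal the same positive integer (its value) and occupy consecutive positions. A segmentation of $R$ is a finite multiset of segments summing to $R$. Setting $R[0]=R[n+1]=0$, a marker of $R$ is an index $j\in\{1,\dots,n+1\}$ with $R[j-1]\ne R[j]$. -}

module Defs where

open import Data.Nat using (ℕ; zero; suc; _+_; _≤_; _<_; _<?_; _≟_)
open import Data.Fin using (Fin; toℕ; fromℕ<)
open import Data.List using (List; []; _∷_; length; filter; upTo; map; foldr)
open import Data.Bool using (Bool; true; false; if_then_else_)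
open import Relation.Nullary using (Dec; yes; no; ¬_)
open import Relation.Nullary.Decidable using (⌊_⌋)

-- A 1×n row: positions are Fin n (position k here is R[k+1] in the paper).
Row : ℕ → Set
Row n = Fin n → ℕ

-- A segment of a 1×n row, given by its value (a positive integer) and the
-- set of consecutive positions {start, …, start+len-1} of its nonzero
-- entries (len ≥ 1, start+len ≤ n), in 0-based indexing.
record Segment (n : ℕ) : Set where
  constructor segment
  field
    value     : ℕ
    start     : ℕ
    len       : ℕ
    value-pos : 1 ≤ value
    len-pos   : 1 ≤ len
    fits      : start + len ≤ n

open Segment public

segRow : ∀ {n} → Segment n → Row n
segRow s k with start s ≤? toℕ k | toℕ k <? start s + len s
  where open import Data.Nat using (_≤?_)
... | yes _ | yes _ = value s
... | _     | _     = 0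

sumSegs : ∀ {n} → List (Segment n) → Row n
sumSegs []       k = 0
sumSegs (s ∷ ss) k = segRow s k + sumSegs ss k

IsSegmentation : ∀ {n} → Row n → List (Segment n) → Set
IsSegmentation R ss = ∀ k → sumSegs ss k ≡ R k
  where open import Relation.Binary.PropositionalEquality using (_≡_)

countValue : ∀ {n} → ℕ → List (Segment n) → ℕ
countValue v ss = length (filter (λ s → value s ≟ v) ss)

-- Extended row with R[0] = R[n+1] = 0 (1-based indexing as in the paper).
ext : ∀ {n} → Row n → ℕ → ℕ
ext {n} R zero = 0
ext {n} R (suc k) with k <? n
... | yes k<n = R (fromℕ< k<n)
... | no  _   = 0

markers : ∀ {n} → Row n → ℕ
markers {n} R = length (filter (λ i → Relation.Nullary.¬? (ext R i ≟ ext R (suc i))) (upTo (suc n)))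
  where import Relation.Nullary

module Submission where

-- Write every entry of R as a sum of three 0/1 layers: a lower and an upper
-- layer of value 1 and a layer of value 2.  We record this by a "cover" of each
-- position (empty, single, stacked = 1+1, double = 2).  Each layer, being a
-- 0/1 row times its value, is segmented by its maximal runs, and a 0/1 row b
-- has exactly (switches b)/2 runs, where switches b counts the positions j
-- with b[j-1] ≠ b[j] (padding with 0).  So it suffices to choose the covers.
--
-- Entries 0 and 1 are covered in the only possible way; a maximal run of 2s is
-- covered either all stacked or all double.  Let z ∈ {0,1,2} be the number of
-- 0-neighbours of such a run.  Scanning the row from left to right, summing
-- local contributions and using a potential inside the current run, one gets
--   switches(lower) + switches(upper) + Σ_double z ≤ ρ + Σ_stacked z,
--   2·switches(double) + 2·#stacked ≤ ρ + 2·#double,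
-- where ρ is the number of markers.  It therefore remains to label the runs so
-- that Σ_stacked z ≤ Σ_double z and #double ≤ #stacked + 1; this is achieved by
-- pairing consecutive runs and making the heavier run of each pair double.

open import Defs
open import Data.Nat using (ℕ; _+_; _*_; _≤_)
open import Data.Fin using (Fin)
open import Data.List using (List)
open import Data.Product using (Σ; _×_)

open import Data.Nat using (zero; suc; _≤ᵇ_; _<ᵇ_; z≤n; s≤s; s≤s⁻¹; _<?_; _≟_)
open import Data.Nat.Properties
open import Data.Nat.Tactic.RingSolver using (solve-∀)
open import Data.Fin using (toℕ) renaming (zero to fzero; suc to fsuc)
open import Data.List using ([]; _∷_; _++_; length; filter; map; drop; applyUpTo)
open import Data.List.Properties using (length-map; length-++; filter-++; filter-all; filter-none; drop-drop)
open import Data.List.Relation.Unary.All as All using (All; []; _∷_)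
open import Data.List.Relation.Unary.All.Properties using (map⁺; ++⁺)
open import Data.Bool using (Bool; true; false; not; _∧_; _xor_; if_then_else_; T)
open import Data.Empty using (⊥; ⊥-elim)
open import Data.Product using (_,_; proj₁; proj₂)
open import Function using (_∘_; id)
open import Relation.Binary.PropositionalEquality
open import Relation.Nullary using (does; yes; no; ¬?)
open import Algebra.Properties.CommutativeSemigroup +-commutativeSemigroup using (interchange)

bit : Bool → ℕ
bit true  = 1
bit false = 0

evaluate : ∀ {m n} {_ : T (m ≤ᵇ n)} → m ≤ n
evaluate {m} {n} {ok} = ≤ᵇ⇒≤ m n ok

add-cancel : ∀ {a b c d p q p′ q′} →
  a + p + q′ ≤ b + q + p′ → c + p′ ≤ d + q′ → a + c + p ≤ b + d + q
add-cancel {a} {b} {c} {d} {p} {q} {p′} {q′} h₁ h₂ =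
  +-cancelʳ-≤ (p′ + q′) _ _ (subst₂ _≤_ (regroupˡ a c p p′ q′) (regroupʳ b d q p′ q′) (+-mono-≤ h₁ h₂))
  where
  regroupˡ : ∀ a c p p′ q′ → a + p + q′ + (c + p′) ≡ a + c + p + (p′ + q′)
  regroupˡ = solve-∀
  regroupʳ : ∀ b d q p′ q′ → b + q + p′ + (d + q′) ≡ b + d + q + (p′ + q′)
  regroupʳ = solve-∀

cancel-through : ∀ {a c d e} → a + c ≤ d → d ≤ e + c → a ≤ e
cancel-through {a} {c} {d} {e} h₁ h₂ = +-cancelʳ-≤ c a e (≤-trans h₁ h₂)

tail : ∀ {A : Set} {n} → (Fin (suc n) → A) → Fin n → A
tail R k = R (fsuc k)

pairSum : ∀ {A : Set} → (A → A → ℕ) → A → A → (n : ℕ) → (Fin n → A) → ℕ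
pairSum f p e zero    R = f p e
pairSum f p e (suc n) R = f p (R fzero) + pairSum f (R fzero) e n (tail R)

pairSum-cong : ∀ {A : Set} (f : A → A → ℕ) p e n {R R′ : Fin n → A} →
  (∀ k → R k ≡ R′ k) → pairSum f p e n R ≡ pairSum f p e n R′
pairSum-cong f p e zero    eq = refl
pairSum-cong f p e (suc n) eq rewrite eq fzero =
  cong (f p _ +_) (pairSum-cong f _ e n (eq ∘ fsuc))

differ : ℕ → ℕ → ℕ
differ x y = if does (x ≟ y) then 0 else 1

switch : Bool → Bool → ℕ
switch a b = bit (a xor b)

switches : ∀ {n} → (Fin n → Bool) → ℕ
switches {n} b = pairSum switch false false n b

sumUpTo : (ℕ → ℕ) → ℕ → ℕ
sumUpTo h zero    = 0
sumUpTo h (suc m) = h 0 + sumUpTo (h ∘ suc) m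

sumUpTo-cong : ∀ {h h′} m → (∀ i → h i ≡ h′ i) → sumUpTo h m ≡ sumUpTo h′ m
sumUpTo-cong zero    eq = refl
sumUpTo-cong (suc m) eq = cong₂ _+_ (eq 0) (sumUpTo-cong m (eq ∘ suc))

length-filter-changes : ∀ (g f : ℕ → ℕ) m →
  length (filter (λ i → ¬? (g i ≟ g (suc i))) (applyUpTo f m))
    ≡ sumUpTo (λ i → differ (g (f i)) (g (suc (f i)))) m
length-filter-changes g f zero = refl
length-filter-changes g f (suc m) with does (g (f 0) ≟ g (suc (f 0)))
... | true  = length-filter-changes g (f ∘ suc) m
... | false = cong suc (length-filter-changes g (f ∘ suc) m)

ext-tail : ∀ {n} (R : Row (suc n)) i → ext R (suc (suc i)) ≡ ext (tail R) (suc i)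
ext-tail {n} R i with suc i <? suc n | i <? n
... | yes _  | yes _  = refl
... | no _   | no _   = refl
... | yes p  | no ¬q  = ⊥-elim (¬q (s≤s⁻¹ p))
... | no ¬p  | yes q  = ⊥-elim (¬p (s≤s q))

padded : ∀ {n} → ℕ → Row n → ℕ → ℕ
padded p R zero    = p
padded p R (suc i) = ext R (suc i)

padded-changes : ∀ n p (R : Row n) →
  sumUpTo (λ i → differ (padded p R i) (padded p R (suc i))) (suc n) ≡ pairSum differ p 0 n R
padded-changes zero    p R = +-identityʳ _
padded-changes (suc n) p R =
  cong (differ p (R fzero) +_) (trans (sumUpTo-cong (suc n) shifted) (padded-changes n (R fzero) (tail R)))
  where
  shifted : ∀ i → differ (padded p R (suc i)) (padded p R (suc (suc i)))
                ≡ differ (padded (R fzero) (tail R) i) (padded (R fzero) (tail R) (suc i))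
  shifted zero    = cong (differ (R fzero)) (ext-tail R 0)
  shifted (suc i) = cong₂ differ (ext-tail R i) (ext-tail R (suc i))

markers-pairSum : ∀ n (R : Row n) → markers R ≡ pairSum differ 0 0 n R
markers-pairSum n R =
  trans (length-filter-changes (ext R) id (suc n)) (trans (sumUpTo-cong (suc n) same) (padded-changes n 0 R))
  where
  same : ∀ i → differ (ext R i) (ext R (suc i)) ≡ differ (padded 0 R i) (padded 0 R (suc i))
  same zero    = refl
  same (suc i) = refl

shift : ∀ {n} → Segment n → Segment (suc n)
shift (segment v s l v≥1 l≥1 fits) = segment v (suc s) l v≥1 l≥1 (s≤s fits)

true-if : ∀ {b} → T b → b ≡ true
true-if {true} _ = refl

false-if : ∀ {b} → (T b → ⊥) → b ≡ false
false-if {false} _  = refl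
false-if {true}  ¬b = ⊥-elim (¬b _)

segRow-≡ : ∀ {n} (s : Segment n) k → segRow s k ≡
  (if (start s ≤ᵇ toℕ k) ∧ (toℕ k <ᵇ start s + len s) then value s else 0)
segRow-≡ s k with start s ≤? toℕ k | toℕ k <? start s + len s
... | yes p | yes q rewrite true-if (≤⇒≤ᵇ p) | true-if (<⇒<ᵇ q)                    = refl
... | yes p | no ¬q rewrite true-if (≤⇒≤ᵇ p) | false-if (¬q ∘ <ᵇ⇒< _ _)            = refl
... | no ¬p | _     rewrite false-if (¬p ∘ ≤ᵇ⇒≤ (start s) (toℕ k))                 = refl

≤ᵇ-suc : ∀ m n → (suc m ≤ᵇ suc n) ≡ (m ≤ᵇ n)
≤ᵇ-suc zero    n = refl
≤ᵇ-suc (suc m) n = refl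

segRow-shift-zero : ∀ {n} (s : Segment n) → segRow (shift s) fzero ≡ 0
segRow-shift-zero s = segRow-≡ (shift s) fzero

segRow-shift-suc : ∀ {n} (s : Segment n) k → segRow (shift s) (fsuc k) ≡ segRow s k
segRow-shift-suc s k =
  trans (segRow-≡ (shift s) (fsuc k))
    (trans (cong (λ b → if b ∧ (toℕ k <ᵇ start s + len s) then value s else 0) (≤ᵇ-suc (start s) (toℕ k)))
      (sym (segRow-≡ s k)))

sumSegs-++ : ∀ {n} (xs ys : List (Segment n)) k → sumSegs (xs ++ ys) k ≡ sumSegs xs k + sumSegs ys k
sumSegs-++ []       ys k = refl
sumSegs-++ (x ∷ xs) ys k = trans (cong (segRow x k +_) (sumSegs-++ xs ys k)) (sym (+-assoc (segRow x k) _ _))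

sumSegs-shift-zero : ∀ {n} (ss : List (Segment n)) → sumSegs (map shift ss) fzero ≡ 0
sumSegs-shift-zero []       = refl
sumSegs-shift-zero (s ∷ ss) = cong₂ _+_ (segRow-shift-zero s) (sumSegs-shift-zero ss)

sumSegs-shift-suc : ∀ {n} (ss : List (Segment n)) k → sumSegs (map shift ss) (fsuc k) ≡ sumSegs ss k
sumSegs-shift-suc []       k = refl
sumSegs-shift-suc (s ∷ ss) k = cong₂ _+_ (segRow-shift-suc s k) (sumSegs-shift-suc ss k)

countValue-++ : ∀ {n} v (xs ys : List (Segment n)) → countValue v (xs ++ ys) ≡ countValue v xs + countValue v ys
countValue-++ v xs ys = trans (cong length (filter-++ (λ s → value s ≟ v) xs ys)) (length-++ (filter (λ s → value s ≟ v) xs))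

OfValue : ∀ {n} → ℕ → List (Segment n) → Set
OfValue v ss = All (λ s → value s ≡ v) ss

countValue-same : ∀ {n v} {ss : List (Segment n)} → OfValue v ss → countValue v ss ≡ length ss
countValue-same {v = v} ok = cong length (filter-all (λ s → value s ≟ v) ok)

countValue-other : ∀ {n v w} {ss : List (Segment n)} → OfValue v ss → (w ≡ v → ⊥) → countValue w ss ≡ 0
countValue-other {w = w} ok w≢v =
  cong length (filter-none (λ s → value s ≟ w) (All.map (λ v≡ w≡ → w≢v (trans (sym w≡) v≡)) ok))

startsTrue : ∀ {n} → (Fin n → Bool) → Bool
startsTrue {zero}  b = false
startsTrue {suc n} b = b fzero

leadingRun : ∀ {n} → (Fin n → Bool) → ℕ
leadingRun {zero}  b = 0
leadingRun {suc n} b = if b fzero then suc (leadingRun (tail b)) else 0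

leadingRun-≤ : ∀ {n} (b : Fin n → Bool) → leadingRun b ≤ n
leadingRun-≤ {zero}  b = z≤n
leadingRun-≤ {suc n} b with b fzero
... | true  = s≤s (leadingRun-≤ (tail b))
... | false = z≤n

below : ℕ → ℕ → ℕ → ℕ
below v m i = if i <ᵇ m then v else 0

module Runs (v : ℕ) (v≥1 : 1 ≤ v) where

  initial : ∀ {n} m → m ≤ n → List (Segment n)
  initial zero    _   = []
  initial (suc m) m≤n = segment v 0 (suc m) v≥1 (s≤s z≤n) m≤n ∷ []

  firstRun : ∀ {n} → (Fin n → Bool) → List (Segment n)
  firstRun b = initial (leadingRun b) (leadingRun-≤ b)

  laterRuns : ∀ {n} → (Fin n → Bool) → List (Segment n)
  laterRuns {zero}  b = []
  laterRuns {suc n} b = map shift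
    (if b fzero then laterRuns (tail b)
     else firstRun (tail b) ++ laterRuns (tail b))

  runs : ∀ {n} → (Fin n → Bool) → List (Segment n)
  runs b = firstRun b ++ laterRuns b

  initial-value : ∀ {n} m (m≤n : m ≤ n) → OfValue v (initial m m≤n)
  initial-value zero    _ = []
  initial-value (suc m) _ = refl ∷ []

  laterRuns-value : ∀ {n} (b : Fin n → Bool) → OfValue v (laterRuns b)
  laterRuns-value {zero}  b = []
  laterRuns-value {suc n} b with b fzero
  ... | true  = map⁺ (laterRuns-value (tail b))
  ... | false = map⁺ (++⁺ (initial-value _ (leadingRun-≤ (tail b))) (laterRuns-value (tail b)))

  runs-value : ∀ {n} (b : Fin n → Bool) → OfValue v (runs b)
  runs-value b = ++⁺ (initial-value _ (leadingRun-≤ b)) (laterRuns-value b)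

  initial-sum : ∀ {n} m (m≤n : m ≤ n) k → sumSegs (initial m m≤n) k ≡ below v m (toℕ k)
  initial-sum zero    _   k = refl
  initial-sum (suc m) m≤n k = trans (+-identityʳ _) (segRow-≡ (segment v 0 (suc m) v≥1 (s≤s z≤n) m≤n) k)

  laterRuns-sum : ∀ {n} (b : Fin n → Bool) k →
    sumSegs (laterRuns b) k + below v (leadingRun b) (toℕ k) ≡ (if b k then v else 0)
  laterRuns-sum {suc n} b fzero with b fzero
  ... | true  = cong (_+ v) (sumSegs-shift-zero (laterRuns (tail b)))
  ... | false = cong (_+ 0) (sumSegs-shift-zero (firstRun (tail b) ++ laterRuns (tail b)))
  laterRuns-sum {suc n} b (fsuc k) with b fzero
  ... | true  = trans (cong (_+ _) (sumSegs-shift-suc (laterRuns (tail b)) k)) (laterRuns-sum (tail b) k)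
  ... | false = begin
    sumSegs (map shift (first ++ rest)) (fsuc k) + 0   ≡⟨ +-identityʳ _ ⟩
    sumSegs (map shift (first ++ rest)) (fsuc k)       ≡⟨ sumSegs-shift-suc (first ++ rest) k ⟩
    sumSegs (first ++ rest) k                          ≡⟨ sumSegs-++ first rest k ⟩
    sumSegs first k + sumSegs rest k                   ≡⟨ +-comm (sumSegs first k) _ ⟩
    sumSegs rest k + sumSegs first k                   ≡⟨ cong (sumSegs rest k +_) (initial-sum _ (leadingRun-≤ (tail b)) k) ⟩
    sumSegs rest k + below v (leadingRun (tail b)) (toℕ k) ≡⟨ laterRuns-sum (tail b) k ⟩
    (if b (fsuc k) then v else 0)                       ∎
    where
    open ≡-Reasoning
    first rest : List (Segment n)
    first = firstRun (tail b)
    rest  = laterRuns (tail b)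

  runs-sum : ∀ {n} (b : Fin n → Bool) k → sumSegs (runs b) k ≡ (if b k then v else 0)
  runs-sum b k =
    trans (sumSegs-++ (firstRun b) (laterRuns b) k)
      (trans (+-comm (sumSegs (firstRun b) k) _)
        (trans (cong (sumSegs (laterRuns b) k +_) (initial-sum _ (leadingRun-≤ b) k)) (laterRuns-sum b k)))

  firstRun-length : ∀ {n} (b : Fin n → Bool) → length (firstRun b) ≡ bit (startsTrue b)
  firstRun-length {zero}  b = refl
  firstRun-length {suc n} b with b fzero
  ... | true  = refl
  ... | false = refl

  -- Every later run contributes two switches, the initial run one (its end)
  -- plus one at the left border when the padding p differs from its start.
  laterRuns-switches : ∀ p {n} (b : Fin n → Bool) →
    pairSum switch p false n b ≡ 2 * length (laterRuns b) + bit (startsTrue b) + bit (p xor startsTrue b)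
  laterRuns-switches p {zero}  b = refl
  laterRuns-switches p {suc n} b with b fzero
  ... | true  = begin
    bit (p xor true) + pairSum switch true false n (tail b)
      ≡⟨ cong (bit (p xor true) +_) (laterRuns-switches true (tail b)) ⟩
    bit (p xor true) + (2 * length rest + bit s + bit (not s))
      ≡⟨ cong (bit (p xor true) +_) (trans (+-assoc (2 * length rest) _ _) (cong (2 * length rest +_) (exactly-one s))) ⟩
    bit (p xor true) + (2 * length rest + 1)
      ≡⟨ +-comm (bit (p xor true)) (2 * length rest + 1) ⟩
    2 * length rest + 1 + bit (p xor true)
      ≡⟨ cong (λ m → 2 * m + 1 + bit (p xor true)) (sym (length-map shift rest)) ⟩
    2 * length (map shift rest) + 1 + bit (p xor true) ∎
    where
    open ≡-Reasoning
    rest : List (Segment n)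
    rest = laterRuns (tail b)
    s : Bool
    s = startsTrue (tail b)
    exactly-one : ∀ s → bit s + bit (not s) ≡ 1
    exactly-one true  = refl
    exactly-one false = refl
  ... | false = begin
    bit (p xor false) + pairSum switch false false n (tail b)
      ≡⟨ cong (bit (p xor false) +_) (laterRuns-switches false (tail b)) ⟩
    bit (p xor false) + (2 * length rest + bit s + bit s)
      ≡⟨ regroup (bit (p xor false)) (length rest) (bit s) ⟩
    2 * (bit s + length rest) + 0 + bit (p xor false)
      ≡⟨ cong (λ m → 2 * m + 0 + bit (p xor false))
           (sym (trans (length-map shift (first ++ rest)) (trans (length-++ first) (cong (_+ length rest) (firstRun-length (tail b)))))) ⟩
    2 * length (map shift (first ++ rest)) + 0 + bit (p xor false) ∎
    where
    open ≡-Reasoning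
    first rest : List (Segment n)
    first = firstRun (tail b)
    rest  = laterRuns (tail b)
    s : Bool
    s = startsTrue (tail b)
    regroup : ∀ a l s → a + (2 * l + s + s) ≡ 2 * (s + l) + 0 + a
    regroup = solve-∀

  runs-switches : ∀ {n} (b : Fin n → Bool) → 2 * length (runs b) ≡ switches b
  runs-switches b = begin
    2 * length (runs b)                                     ≡⟨ cong (2 *_) (trans (length-++ (firstRun b)) (cong (_+ length (laterRuns b)) (firstRun-length b))) ⟩
    2 * (bit s + length (laterRuns b))                      ≡⟨ regroup (bit s) (length (laterRuns b)) ⟩
    2 * length (laterRuns b) + bit s + bit s                ≡⟨ sym (laterRuns-switches false b) ⟩
    switches b                                              ∎
    where
    open ≡-Reasoning
    s : Bool
    s = startsTrue b
    regroup : ∀ s l → 2 * (s + l) ≡ 2 * l + s + s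
    regroup = solve-∀

data Cover : Set where
  empty   : Cover
  single  : Cover
  stacked : Cover
  double  : Cover

entry : Cover → ℕ
entry empty   = 0
entry single  = 1
entry stacked = 2
entry double  = 2

inLower inUpper inDouble : Cover → Bool
inLower single  = true
inLower stacked = true
inLower _       = false
inUpper stacked = true
inUpper _       = false
inDouble double = true
inDouble _      = false

layers-sum : ∀ c → (if inLower c then 1 else 0) + ((if inUpper c then 1 else 0) + (if inDouble c then 2 else 0)) ≡ entry c
layers-sum empty   = refl
layers-sum single  = refl
layers-sum stacked = refl
layers-sum double  = refl

-- The choice for the next run (true: double); missing choices mean stacked.
current : List Bool → Bool
current []      = false
current (c ∷ _) = c

tally : (ℕ → ℕ) → Bool → List Bool → List ℕ → ℕ
tally f b cs []       = 0
tally f b cs (z ∷ zs) = (if current cs xor b then 0 else f z) + tally f b (drop 1 cs) zs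

tally-++ : ∀ f b cs (xs ys : List ℕ) → tally f b cs (xs ++ ys) ≡ tally f b cs xs + tally f b (drop (length xs) cs) ys
tally-++ f b cs []       ys = refl
tally-++ f b cs (x ∷ xs) ys = begin
  here + tally f b (drop 1 cs) (xs ++ ys)
    ≡⟨ cong (here +_) (tally-++ f b (drop 1 cs) xs ys) ⟩
  here + (tally f b (drop 1 cs) xs + tally f b (drop (length xs) (drop 1 cs)) ys)
    ≡⟨ sym (+-assoc here _ _) ⟩
  here + tally f b (drop 1 cs) xs + tally f b (drop (length xs) (drop 1 cs)) ys
    ≡⟨ cong (λ ds → here + tally f b (drop 1 cs) xs + tally f b ds ys) (drop-drop 1 (length xs) cs) ⟩
  here + tally f b (drop 1 cs) xs + tally f b (drop (suc (length xs)) cs) ys ∎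
  where
  open ≡-Reasoning
  here = if current cs xor b then 0 else f x

heavy many : Bool → List Bool → List ℕ → ℕ
heavy = tally id
many  = tally (λ _ → 1)

-- Pairing consecutive runs and making the heavier one of each pair double
-- (and a last unpaired run double) balances both weight and number.
pairing : ∀ zs → Σ (List Bool) λ cs →
  heavy false cs zs ≤ heavy true cs zs × many true cs zs ≤ suc (many false cs zs)
pairing []       = [] , z≤n , z≤n
pairing (z ∷ []) = true ∷ [] , z≤n , ≤-refl
pairing (z₁ ∷ z₂ ∷ zs) with pairing zs | z₂ ≤? z₁
... | cs , lighter , fewer | yes z₂≤z₁ = true ∷ false ∷ cs , +-mono-≤ z₂≤z₁ lighter , s≤s fewer
... | cs , lighter , fewer | no z₂≰z₁  = false ∷ true ∷ cs , +-mono-≤ (<⇒≤ (≰⇒> z₂≰z₁)) lighter , s≤s fewer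

data Phase : Set where
  between : Bool → Phase   -- after an entry other than 2; flag: it is 0 (or the left border)
  within  : Bool → Phase   -- inside a run of 2s; flag: the run's left neighbour is 0

-- The phase after reading the entry x; entries above 2 are read as 2.
advance : Phase → ℕ → Phase
advance _           zero          = between true
advance _           (suc zero)    = between false
advance (between z) (suc (suc _)) = within z
advance (within z)  (suc (suc _)) = within z

-- The weight (number of 0-neighbours) of the run that is closed by reading x.
closed : Phase → ℕ → List ℕ
closed (within z) zero       = bit z + 1 ∷ []
closed (within z) (suc zero) = bit z ∷ []
closed _          _          = []

weights : Phase → (n : ℕ) → Row n → List ℕ
weights ph zero    R = closed ph 0
weights ph (suc n) R = closed ph (R fzero) ++ weights (advance ph (R fzero)) n (tail R)

record State : Set where
  constructor ⟨_,_⟩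
  field
    phase   : Phase
    choices : List Bool
open State

next : State → ℕ → State
next ⟨ ph , cs ⟩ x = ⟨ advance ph x , drop (length (closed ph x)) cs ⟩

coverOf : State → Cover
coverOf ⟨ between true  , _  ⟩ = empty
coverOf ⟨ between false , _  ⟩ = single
coverOf ⟨ within _      , cs ⟩ = if current cs then double else stacked

covers : State → (n : ℕ) → Row n → Fin n → Cover
covers σ (suc n) R fzero    = coverOf (next σ (R fzero))
covers σ (suc n) R (fsuc k) = covers (next σ (R fzero)) n (tail R) k

covers-entry : ∀ σ n (R : Row n) → (∀ k → R k ≤ 2) → ∀ k → entry (covers σ n R k) ≡ R k
covers-entry σ (suc n) R bounded fzero    = entry-next σ (R fzero) (bounded fzero)
  where
  entry-next : ∀ σ x → x ≤ 2 → entry (coverOf (next σ x)) ≡ x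
  entry-next σ                  zero                _ = refl
  entry-next σ                  (suc zero)          _ = refl
  entry-next ⟨ between _ , cs ⟩ (suc (suc zero))    _ with current cs
  ... | true  = refl
  ... | false = refl
  entry-next ⟨ within _ , cs ⟩  (suc (suc zero))    _ with current cs
  ... | true  = refl
  ... | false = refl
  entry-next σ                  (suc (suc (suc _))) (s≤s (s≤s ()))
covers-entry σ (suc n) R bounded (fsuc k) = covers-entry (next σ (R fzero)) n (tail R) (bounded ∘ fsuc) k

stepSum : (State → ℕ → ℕ) → State → (n : ℕ) → Row n → ℕ
stepSum q σ zero    R = q σ 0
stepSum q σ (suc n) R = q σ (R fzero) + stepSum q (next σ (R fzero)) n (tail R)

stepSum-+ : ∀ q r σ n (R : Row n) → stepSum (λ σ x → q σ x + r σ x) σ n R ≡ stepSum q σ n R + stepSum r σ n R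
stepSum-+ q r σ zero    R = refl
stepSum-+ q r σ (suc n) R =
  trans (cong (q σ x + r σ x +_) (stepSum-+ q r (next σ x) n (tail R))) (interchange (q σ x) (r σ x) _ _)
  where
  x : ℕ
  x = R fzero

stepSum-* : ∀ m q σ n (R : Row n) → stepSum (λ σ x → m * q σ x) σ n R ≡ m * stepSum q σ n R
stepSum-* m q σ zero    R = refl
stepSum-* m q σ (suc n) R =
  trans (cong (m * q σ x +_) (stepSum-* m q (next σ x) n (tail R))) (sym (*-distribˡ-+ m (q σ x) _))
  where
  x : ℕ
  x = R fzero

across : ∀ {A : Set} → (Cover → A) → (A → A → ℕ) → State → ℕ → ℕ
across g f σ x = f (g (coverOf σ)) (g (coverOf (next σ x)))

emitted : (ℕ → ℕ) → Bool → State → ℕ → ℕ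
emitted f b σ x = tally f b (choices σ) (closed (phase σ) x)

pairSum-covers : ∀ {A : Set} (g : Cover → A) (f : A → A → ℕ) σ n (R : Row n) →
  pairSum f (g (coverOf σ)) (g empty) n (g ∘ covers σ n R) ≡ stepSum (across g f) σ n R
pairSum-covers g f σ zero    R = refl
pairSum-covers g f σ (suc n) R = cong (across g f σ (R fzero) +_) (pairSum-covers g f (next σ (R fzero)) n (tail R))

tally-weights : ∀ f b σ n (R : Row n) → tally f b (choices σ) (weights (phase σ) n R) ≡ stepSum (emitted f b) σ n R
tally-weights f b σ zero    R = refl
tally-weights f b σ (suc n) R =
  trans (tally-++ f b (choices σ) (closed (phase σ) (R fzero)) _)
    (cong (emitted f b σ (R fzero) +_) (tally-weights f b (next σ (R fzero)) n (tail R)))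

-- Potential argument: if every step satisfies the local inequality, with
-- potentials Φ, Ψ that vanish after the final border, the sums satisfy it too.
telescope : (q₁ q₂ : State → ℕ → ℕ) (Φ Ψ : State → ℕ) →
  (∀ σ x → q₁ σ x + Φ σ + Ψ (next σ x) ≤ q₂ σ x + Ψ σ + Φ (next σ x)) →
  (∀ σ → Φ (next σ 0) ≡ 0) → (∀ σ → Ψ (next σ 0) ≡ 0) →
  ∀ σ n (R : Row n) → stepSum q₁ σ n R + Φ σ ≤ stepSum q₂ σ n R + Ψ σ
telescope q₁ q₂ Φ Ψ local Φ-end Ψ-end σ zero R =
  subst₂ _≤_ (drop-zero (Ψ-end σ)) (drop-zero (Φ-end σ)) (local σ 0)
  where
  drop-zero : ∀ {a b} → b ≡ 0 → a + b ≡ a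
  drop-zero {a} refl = +-identityʳ a
telescope q₁ q₂ Φ Ψ local Φ-end Ψ-end σ (suc n) R =
  add-cancel {q₁ σ x} {q₂ σ x} {stepSum q₁ σ′ n (tail R)} {stepSum q₂ σ′ n (tail R)} {Φ σ} {Ψ σ} {Φ σ′} {Ψ σ′}
    (local σ x) (telescope q₁ q₂ Φ Ψ local Φ-end Ψ-end σ′ n (tail R))
  where
  x : ℕ
  x  = R fzero
  σ′ : State
  σ′ = next σ x

charge : Bool → (Bool → ℕ) → State → ℕ
charge b w ⟨ between _ , _  ⟩ = 0
charge b w ⟨ within z  , cs ⟩ = if current cs xor b then 0 else w z

-- Per step, the switches of the two 1-layers plus the weight of a closed
-- double run are paid by the markers plus the weight of a closed stacked run;
-- the left half of a run's weight is carried as a charge.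
ones-step : ∀ σ x →
  across inLower switch σ x + across inUpper switch σ x + emitted id true σ x
    + charge false bit σ + charge true bit (next σ x)
  ≤ across entry differ σ x + emitted id false σ x + charge true bit σ + charge false bit (next σ x)
ones-step ⟨ between true  , cs ⟩ zero          = evaluate
ones-step ⟨ between false , cs ⟩ zero          = evaluate
ones-step ⟨ between true  , cs ⟩ (suc zero)    = evaluate
ones-step ⟨ between false , cs ⟩ (suc zero)    = evaluate
ones-step ⟨ between true  , cs ⟩ (suc (suc _)) with current cs
... | true  = evaluate
... | false = evaluate
ones-step ⟨ between false , cs ⟩ (suc (suc _)) with current cs
... | true  = evaluate
... | false = evaluate
ones-step ⟨ within true   , cs ⟩ zero          with current cs
... | true  = evaluate
... | false = evaluate
ones-step ⟨ within false  , cs ⟩ zero          with current cs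
... | true  = evaluate
... | false = evaluate
ones-step ⟨ within true   , cs ⟩ (suc zero)    with current cs
... | true  = evaluate
... | false = evaluate
ones-step ⟨ within false  , cs ⟩ (suc zero)    with current cs
... | true  = evaluate
... | false = evaluate
ones-step ⟨ within true   , cs ⟩ (suc (suc _)) with current cs
... | true  = evaluate
... | false = evaluate
ones-step ⟨ within false  , cs ⟩ (suc (suc _)) with current cs
... | true  = evaluate
... | false = evaluate

-- Per step, twice the switches of the 2-layer plus two per closed stacked run
-- are paid by the markers plus two per closed double run; the charges record
-- that a run's first boundary is already counted.
twos-step : ∀ σ x →
  2 * across inDouble switch σ x + 2 * emitted (λ _ → 1) false σ x
    + charge true (λ _ → 1) σ + charge false (λ _ → 1) (next σ x)
  ≤ across entry differ σ x + 2 * emitted (λ _ → 1) true σ x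
    + charge false (λ _ → 1) σ + charge true (λ _ → 1) (next σ x)
twos-step ⟨ between true  , cs ⟩ zero          = evaluate
twos-step ⟨ between false , cs ⟩ zero          = evaluate
twos-step ⟨ between true  , cs ⟩ (suc zero)    = evaluate
twos-step ⟨ between false , cs ⟩ (suc zero)    = evaluate
twos-step ⟨ between true  , cs ⟩ (suc (suc _)) with current cs
... | true  = evaluate
... | false = evaluate
twos-step ⟨ between false , cs ⟩ (suc (suc _)) with current cs
... | true  = evaluate
... | false = evaluate
twos-step ⟨ within z      , cs ⟩ zero          with current cs
... | true  = evaluate
... | false = evaluate
twos-step ⟨ within z      , cs ⟩ (suc zero)    with current cs
... | true  = evaluate
... | false = evaluate
twos-step ⟨ within z      , cs ⟩ (suc (suc _)) with current cs
... | true  = evaluate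
... | false = evaluate

origin : List Bool → State
origin cs = ⟨ between true , cs ⟩

ones-ledger : ∀ cs n (R : Row n) →
  switches (inLower ∘ covers (origin cs) n R) + switches (inUpper ∘ covers (origin cs) n R)
    + heavy true cs (weights (between true) n R)
  ≤ pairSum differ 0 0 n (entry ∘ covers (origin cs) n R) + heavy false cs (weights (between true) n R)
ones-ledger cs n R =
  subst₂ _≤_ lhs rhs (telescope _ _ (charge false bit) (charge true bit) ones-step (λ _ → refl) (λ _ → refl) σ n R)
  where
  σ : State
  σ = origin cs
  lower upper changes : State → ℕ → ℕ
  lower   = across inLower switch
  upper   = across inUpper switch
  changes = across entry differ
  open ≡-Reasoning
  lhs : stepSum (λ σ x → lower σ x + upper σ x + emitted id true σ x) σ n R + 0
      ≡ switches (inLower ∘ covers σ n R) + switches (inUpper ∘ covers σ n R) + heavy true cs (weights (between true) n R)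
  lhs = begin
    stepSum (λ σ x → lower σ x + upper σ x + emitted id true σ x) σ n R + 0
      ≡⟨ +-identityʳ _ ⟩
    stepSum (λ σ x → lower σ x + upper σ x + emitted id true σ x) σ n R
      ≡⟨ stepSum-+ (λ σ x → lower σ x + upper σ x) (emitted id true) σ n R ⟩
    stepSum (λ σ x → lower σ x + upper σ x) σ n R + stepSum (emitted id true) σ n R
      ≡⟨ cong (_+ stepSum (emitted id true) σ n R) (stepSum-+ lower upper σ n R) ⟩
    stepSum lower σ n R + stepSum upper σ n R + stepSum (emitted id true) σ n R
      ≡⟨ sym (cong₂ _+_ (cong₂ _+_ (pairSum-covers inLower switch σ n R) (pairSum-covers inUpper switch σ n R))
                        (tally-weights id true σ n R)) ⟩
    switches (inLower ∘ covers σ n R) + switches (inUpper ∘ covers σ n R) + heavy true cs (weights (between true) n R) ∎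
  rhs : stepSum (λ σ x → changes σ x + emitted id false σ x) σ n R + 0
      ≡ pairSum differ 0 0 n (entry ∘ covers σ n R) + heavy false cs (weights (between true) n R)
  rhs = begin
    stepSum (λ σ x → changes σ x + emitted id false σ x) σ n R + 0
      ≡⟨ trans (+-identityʳ _) (stepSum-+ changes (emitted id false) σ n R) ⟩
    stepSum changes σ n R + stepSum (emitted id false) σ n R
      ≡⟨ sym (cong₂ _+_ (pairSum-covers entry differ σ n R) (tally-weights id false σ n R)) ⟩
    pairSum differ 0 0 n (entry ∘ covers σ n R) + heavy false cs (weights (between true) n R) ∎

twos-ledger : ∀ cs n (R : Row n) →
  2 * switches (inDouble ∘ covers (origin cs) n R) + 2 * many false cs (weights (between true) n R)
  ≤ pairSum differ 0 0 n (entry ∘ covers (origin cs) n R) + 2 * many true cs (weights (between true) n R)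
twos-ledger cs n R =
  subst₂ _≤_ lhs rhs
    (telescope _ _ (charge true (λ _ → 1)) (charge false (λ _ → 1)) twos-step (λ _ → refl) (λ _ → refl) σ n R)
  where
  σ : State
  σ = origin cs
  doubles changes closedD closedS : State → ℕ → ℕ
  doubles  = across inDouble switch
  changes  = across entry differ
  closedD  = emitted (λ _ → 1) true
  closedS  = emitted (λ _ → 1) false
  open ≡-Reasoning
  lhs : stepSum (λ σ x → 2 * doubles σ x + 2 * closedS σ x) σ n R + 0
      ≡ 2 * switches (inDouble ∘ covers σ n R) + 2 * many false cs (weights (between true) n R)
  lhs = begin
    stepSum (λ σ x → 2 * doubles σ x + 2 * closedS σ x) σ n R + 0
      ≡⟨ trans (+-identityʳ _) (stepSum-+ (λ σ x → 2 * doubles σ x) (λ σ x → 2 * closedS σ x) σ n R) ⟩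
    stepSum (λ σ x → 2 * doubles σ x) σ n R + stepSum (λ σ x → 2 * closedS σ x) σ n R
      ≡⟨ cong₂ _+_ (stepSum-* 2 doubles σ n R) (stepSum-* 2 closedS σ n R) ⟩
    2 * stepSum doubles σ n R + 2 * stepSum closedS σ n R
      ≡⟨ sym (cong₂ (λ a b → 2 * a + 2 * b) (pairSum-covers inDouble switch σ n R) (tally-weights (λ _ → 1) false σ n R)) ⟩
    2 * switches (inDouble ∘ covers σ n R) + 2 * many false cs (weights (between true) n R) ∎
  rhs : stepSum (λ σ x → changes σ x + 2 * closedD σ x) σ n R + 0
      ≡ pairSum differ 0 0 n (entry ∘ covers σ n R) + 2 * many true cs (weights (between true) n R)
  rhs = begin
    stepSum (λ σ x → changes σ x + 2 * closedD σ x) σ n R + 0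
      ≡⟨ trans (+-identityʳ _) (stepSum-+ changes (λ σ x → 2 * closedD σ x) σ n R) ⟩
    stepSum changes σ n R + stepSum (λ σ x → 2 * closedD σ x) σ n R
      ≡⟨ cong (stepSum changes σ n R +_) (stepSum-* 2 closedD σ n R) ⟩
    stepSum changes σ n R + 2 * stepSum closedD σ n R
      ≡⟨ sym (cong₂ (λ a b → a + 2 * b) (pairSum-covers entry differ σ n R) (tally-weights (λ _ → 1) true σ n R)) ⟩
    pairSum differ 0 0 n (entry ∘ covers σ n R) + 2 * many true cs (weights (between true) n R) ∎

module Ones = Runs 1 (s≤s z≤n)
module Twos = Runs 2 (s≤s z≤n)

module _ {n : ℕ} (L : Fin n → Cover) where
  private
    lower upper doubles : List (Segment n)
    lower   = Ones.runs (inLower ∘ L)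
    upper   = Ones.runs (inUpper ∘ L)
    doubles = Twos.runs (inDouble ∘ L)

  layered : List (Segment n)
  layered = lower ++ upper ++ doubles

  layered-sum : ∀ k → sumSegs layered k ≡ entry (L k)
  layered-sum k = begin
    sumSegs (lower ++ upper ++ doubles) k
      ≡⟨ trans (sumSegs-++ lower _ k) (cong (sumSegs lower k +_) (sumSegs-++ upper doubles k)) ⟩
    sumSegs lower k + (sumSegs upper k + sumSegs doubles k)
      ≡⟨ cong₂ _+_ (Ones.runs-sum _ k) (cong₂ _+_ (Ones.runs-sum _ k) (Twos.runs-sum _ k)) ⟩
    (if inLower (L k) then 1 else 0) + ((if inUpper (L k) then 1 else 0) + (if inDouble (L k) then 2 else 0))
      ≡⟨ layers-sum (L k) ⟩
    entry (L k) ∎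
    where open ≡-Reasoning

  layered-ones : 2 * countValue 1 layered ≡ switches (inLower ∘ L) + switches (inUpper ∘ L)
  layered-ones = begin
    2 * countValue 1 (lower ++ upper ++ doubles)
      ≡⟨ cong (2 *_) (trans (countValue-++ 1 lower _) (cong (countValue 1 lower +_) (countValue-++ 1 upper doubles))) ⟩
    2 * (countValue 1 lower + (countValue 1 upper + countValue 1 doubles))
      ≡⟨ cong (2 *_) (cong₂ _+_ (countValue-same (Ones.runs-value (inLower ∘ L)))
                                (cong₂ _+_ (countValue-same (Ones.runs-value (inUpper ∘ L)))
                                           (countValue-other (Twos.runs-value (inDouble ∘ L)) λ ()))) ⟩
    2 * (length lower + (length upper + 0))
      ≡⟨ cong (λ u → 2 * (length lower + u)) (+-identityʳ _) ⟩
    2 * (length lower + length upper)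
      ≡⟨ *-distribˡ-+ 2 (length lower) _ ⟩
    2 * length lower + 2 * length upper
      ≡⟨ cong₂ _+_ (Ones.runs-switches (inLower ∘ L)) (Ones.runs-switches (inUpper ∘ L)) ⟩
    switches (inLower ∘ L) + switches (inUpper ∘ L) ∎
    where open ≡-Reasoning

  layered-twos : 4 * countValue 2 layered ≡ 2 * switches (inDouble ∘ L)
  layered-twos = begin
    4 * countValue 2 (lower ++ upper ++ doubles)
      ≡⟨ cong (4 *_) (trans (countValue-++ 2 lower _) (cong (countValue 2 lower +_) (countValue-++ 2 upper doubles))) ⟩
    4 * (countValue 2 lower + (countValue 2 upper + countValue 2 doubles))
      ≡⟨ cong (4 *_) (cong₂ _+_ (countValue-other (Ones.runs-value (inLower ∘ L)) λ ())
                                (cong₂ _+_ (countValue-other (Ones.runs-value (inUpper ∘ L)) λ ())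
                                           (countValue-same (Twos.runs-value (inDouble ∘ L))))) ⟩
    4 * length doubles
      ≡⟨ *-assoc 2 2 (length doubles) ⟩
    2 * (2 * length doubles)
      ≡⟨ cong (2 *_) (Twos.runs-switches (inDouble ∘ L)) ⟩
    2 * switches (inDouble ∘ L) ∎
    where open ≡-Reasoning

-- Cover R run by run with the balanced choices for its run weights; the two
-- ledgers together with the balance give the two bounds.
lemma1 : (n : ℕ) (R : Row n) → (∀ k → R k ≤ 2) →
    Σ (List (Segment n)) (λ ss → IsSegmentation R ss ×
      (2 * countValue 1 ss ≤ markers R) × (4 * countValue 2 ss ≤ markers R + 2))
lemma1 n R bounded = layered L , sums-to-R , ones-bound , twos-bound
  where
  zs : List ℕ
  zs = weights (between true) n R
  cs : List Bool
  cs = proj₁ (pairing zs)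
  L : Fin n → Cover
  L = covers (origin cs) n R
  ρ : ℕ
  ρ = pairSum differ 0 0 n (entry ∘ L)

  ρ-markers : ρ ≡ markers R
  ρ-markers = trans (pairSum-cong differ 0 0 n (covers-entry (origin cs) n R bounded)) (sym (markers-pairSum n R))

  sums-to-R : IsSegmentation R (layered L)
  sums-to-R k = trans (layered-sum L k) (covers-entry (origin cs) n R bounded k)

  lighter : heavy false cs zs ≤ heavy true cs zs
  lighter = proj₁ (proj₂ (pairing zs))

  fewer : many true cs zs ≤ suc (many false cs zs)
  fewer = proj₂ (proj₂ (pairing zs))

  ones-bound : 2 * countValue 1 (layered L) ≤ markers R
  ones-bound = subst₂ _≤_ (sym (layered-ones L)) ρ-markers
    (cancel-through (ones-ledger cs n R) (+-monoʳ-≤ ρ lighter))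

  twos-bound : 4 * countValue 2 (layered L) ≤ markers R + 2
  twos-bound = subst₂ _≤_ (sym (layered-twos L)) (cong (_+ 2) ρ-markers)
    (cancel-through (twos-ledger cs n R)
      (≤-trans (+-monoʳ-≤ ρ (*-monoʳ-≤ 2 fewer)) (≤-reflexive (trans (cong (ρ +_) (*-suc 2 _)) (sym (+-assoc ρ 2 _))))))
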